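{- For all integers $g,h\ge 0$ with $(g,h)\ne(0,0)$, \[ t(g,h)=t(g,h+1)+t(g-1,h+1)+\hat s(g,h)-2\hat s(g,h+1)+\hat s(g,h+2), \] where $t(-1,k)=0$ for all $k$.
   Context: A numerical semigroup is a subset $\Lambda\subseteq\mathbb{N}_0=\{0,1,2,\dots\}$ that contains $0$, is closed under addition, and has finite complement. Its genus is $g(\Lambda)=|\mathbb{N}_0\setminus\Lambda|$, its multiplicity is $m(\Lambda)=\min(\Lambda\setminus\{0\})$, and its Frobenius number is $f(\Lambda)=\max(\mathbb{N}_0\setminus\Lambda)$, with the convention $f(\mathbb{N}_0)=-1$. The children of $\Lambda$ are the sets $\Lambda\setminus\{x\}$ with $x>f(\Lambda)$ that are again numerical semigroups; the efficacy $h(\Lambda)$ is the number of children. A numerical semigroup $\Lambda\neq\mathbb{N}_0$ is called strongly descended if $\Lambda\setminus\{m(\Lambda)+f(\Lambda)\}$ is a numerical semigroup; by convention $\mathbb{N}_0$ is also strongly descended. For integers $g,h\ge 0$: $t(g,h)$ is the number of numerical semigroups of genus $g$ and efficacy $h$; $s(g,h)$ is the number of strongly descended numerical semigroups of genus $g$ and efficacy $h$; and $\hat s(g,h)=1$ if $g=h$, while $\hat s(g,h)=s(g,h)$ if $g\ne h$. -}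

module Defs where

open import Data.Nat using (ℕ; zero; suc; _+_; _<_; _≤_; _≟_)
open import Data.Fin using (Fin)
open import Data.List using (List; []; _∷_; _++_; [_]; length)
open import Data.List.Membership.Propositional using (_∈_; _∉_)
open import Data.List.Relation.Unary.All using (All)
open import Data.List.Relation.Unary.AllPairs using (AllPairs)
open import Data.Product using (Σ; ∃; _×_; _,_)
open import Data.Sum using (_⊎_)
open import Relation.Binary.PropositionalEquality using (_≡_)
open import Relation.Nullary using (yes; no)

-- A numerical semigroup Λ is represented canonically by its (finite) set of
-- gaps ℕ₀ ∖ Λ, given as a strictly increasing list G; Λ = { x | x ∉ G }.
IsNS : List ℕ → Set
IsNS G = AllPairs _<_ G
       × 0 ∉ G
       × (∀ a b → a ∉ G → b ∉ G → (a + b) ∉ G)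

genus : List ℕ → ℕ
genus G = length G

Frob : List ℕ → ℕ → Set
Frob G f = f ∈ G × All (_≤ f) G

Mult : List ℕ → ℕ → Set
Mult G m = 1 ≤ m × m ∉ G × (∀ k → 1 ≤ k → k < m → k ∈ G)

HasCount : {A : Set} → (A → Set) → ℕ → Set
HasCount {A} P n =
  Σ (Fin n → A) λ e →
    (∀ i → P (e i))
  × (∀ i j → e i ≡ e j → i ≡ j)
  × (∀ a → P a → ∃ λ i → e i ≡ a)

-- x gives a child of Λ: x > f(Λ) (i.e. x exceeds every gap; vacuous when
-- Λ = ℕ₀, matching f(ℕ₀) = -1) and Λ ∖ {x} is a numerical semigroup
-- (its gap list is G ++ [x]).
IsChild : List ℕ → ℕ → Set
IsChild G x = All (_< x) G × IsNS (G ++ [ x ])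

Efficacy : List ℕ → ℕ → Set
Efficacy G h = HasCount (IsChild G) h

StronglyDescended : List ℕ → Set
StronglyDescended G =
  G ≡ [] ⊎ (∃ λ m → ∃ λ f → Mult G m × Frob G f × IsNS (G ++ [ m + f ]))

NSgh : ℕ → ℕ → List ℕ → Set
NSgh g h G = IsNS G × genus G ≡ g × Efficacy G h

-- numerical semigroups of genus g - 1 and efficacy h (empty when g = 0,
-- realising the convention t(-1,k) = 0)
NSpred : ℕ → ℕ → List ℕ → Set
NSpred g h G = IsNS G × suc (genus G) ≡ g × Efficacy G h

SDgh : ℕ → ℕ → List ℕ → Set
SDgh g h G = NSgh g h G × StronglyDescended G

-- ŝ(g,h) given s = s(g,h)
shat : ℕ → ℕ → ℕ → ℕ
shat g h s with g ≟ h
... | yes _ = 1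
... | no _ = s

-- Write a nonempty gap list as P ∷ʳ f: the semigroup Λ is obtained from its parent
-- ℕ₀ ∖ P by removing its Frobenius number f. The children of Λ are the children of the parent that
-- lie above f, together with m + f exactly when Λ is strongly descended and 2f exactly when Λ is
-- ordinary (f < m). So h(Λ) = r(Λ) + [Λ strongly descended] + [Λ ordinary], where the rank r(Λ)
-- is the number of children of the parent above f. For genus g ≥ 1, passing to the parent is a
-- bijection from the semigroups of rank b onto the semigroups of genus g − 1 with more than b
-- children; hence, writing N(b) for the number of semigroups of genus g and rank b,
-- N(b) = t(g − 1, b + 1) + N(b + 1). Sorting by the two indicators, and using that the unique
-- ordinary semigroup of genus g is strongly descended with g + 1 children, gives
-- N(b) = (t(g, b) − s(g, b)) + (s(g, b + 1) − [g = b]) + [g = b + 1]. No semigroup of genus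
-- g ≥ 1 has exactly g children, so s(g, g) = 0 and ŝ absorbs the corrections.

module Submission where

open import Data.Empty using (⊥-elim)
open import Data.Fin using (zero; suc)
open import Data.Integer using (+_; _-_) renaming (_+_ to _+ℤ_; _*_ to _*ℤ_)
open import Data.Integer.Properties using (pos-+; pos-*)
import Data.Integer.Tactic.RingSolver as ℤ-Solver
open import Data.List using (List; []; _∷_; _++_; _∷ʳ_; [_]; length; filter; tabulate; lookup; applyUpTo; upTo)
open import Data.List.Membership.Propositional using (_∈_; _∉_)
open import Data.List.Membership.Propositional.Properties
  using (∈-filter⁺; ∈-filter⁻; ∈-tabulate⁺; ∈-tabulate⁻; ∈-lookup; ∈-++⁺ˡ; ∈-++⁺ʳ; ∈-++⁻;
         ∈-applyUpTo⁺; ∈-applyUpTo⁻; ∈-upTo⁺; ∈-upTo⁻)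
open import Data.List.Membership.Propositional.Properties.WithK using (unique∧set⇒bag)
open import Data.List.Properties
  using (length-tabulate; length-++; length-applyUpTo; length-filter; filter-notAll; filter-reject; filter-all)
open import Data.List.Relation.Binary.BagAndSetEquality using (∼bag⇒↭)
open import Data.List.Relation.Binary.Permutation.Propositional.Properties using (↭-length)
open import Data.List.Relation.Unary.All as All using (All; []; _∷_; all?)
import Data.List.Relation.Unary.All.Properties as AllP
open import Data.List.Relation.Unary.AllPairs as AllPairs using (AllPairs; []; _∷_; allPairs?)
import Data.List.Relation.Unary.AllPairs.Properties as AllPairsP
open import Data.List.Relation.Unary.Any as Any using (here; there; index)
open import Data.List.Relation.Unary.Any.Properties using (lookup-index)
open import Data.List.Relation.Unary.Unique.Propositional using (Unique)
import Data.List.Relation.Unary.Unique.Propositional.Properties as Unique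
open import Data.Nat using (ℕ; zero; suc; _+_; _*_; _∸_; _≤_; _<_; z≤n; s≤s; _≟_; _<?_; _≤?_)
open import Data.Nat.Properties
import Data.Nat.Tactic.RingSolver as ℕ-Solver
open import Data.List.Membership.DecPropositional _≟_ using (_∈?_)
open import Data.Product using (∃; _×_; _,_; proj₁; proj₂)
open import Data.Sum using (_⊎_; inj₁; inj₂; [_,_]′)
open import Function using (_∘_; id)
open import Function.Bundles using (_⇔_; mk⇔; Equivalence)
open import Level using (0ℓ)
open import Relation.Binary.Definitions using (tri<; tri≈; tri>) renaming (Decidable to Decidable₂)
open import Relation.Binary.PropositionalEquality
  using (_≡_; _≢_; refl; sym; trans; cong; cong₂; subst; subst₂; module ≡-Reasoning)
open import Relation.Nullary using (¬_; Dec; yes; no; ¬?)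
open import Relation.Nullary.Decidable using (_×-dec_; _⊎-dec_; map′)
open import Relation.Unary using (Pred; Decidable; _∩_; _∪_; ∁; _⊆_; _≐_)
open import Relation.Unary.Properties using (∁?; ≐-sym)

open import Defs

private variable
  A B : Set
  P Q R : Pred A 0ℓ
  xs : List A
  k n n₁ n₂ : ℕ

-- Counting through duplicate-free listings

𝟙 : Dec B → ℕ
𝟙 (yes _) = 1
𝟙 (no _)  = 0

record Listing (P : Pred A 0ℓ) (xs : List A) : Set where
  field
    unique   : Unique xs
    complete : ∀ {a} → P a → a ∈ xs
    sound    : ∀ {a} → a ∈ xs → P a
open Listing

listing-length : ∀ {ys} → Listing P xs → Listing Q ys → P ≐ Q → length xs ≡ length ys
listing-length L M (P⊆Q , Q⊆P) = ↭-length (∼bag⇒↭ (unique∧set⇒bag (unique L) (unique M)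
  (mk⇔ (complete M ∘ P⊆Q ∘ sound L) (complete L ∘ Q⊆P ∘ sound M))))

count⇒listing : HasCount P n → ∃ λ xs → Listing P xs × length xs ≡ n
count⇒listing {P = P} (e , Pe , e-inj , e-onto) = tabulate e , L , length-tabulate e
  where
  L : Listing P (tabulate e)
  L .unique = Unique.tabulate⁺ (e-inj _ _)
  L .complete Pa with i , refl ← e-onto _ Pa = ∈-tabulate⁺ i
  L .sound a∈ with i , refl ← ∈-tabulate⁻ a∈ = Pe i

lookup-injective : Unique xs → ∀ i j → lookup xs i ≡ lookup xs j → i ≡ j
lookup-injective {xs = _ ∷ _} u zero zero eq = refl
lookup-injective {xs = _ ∷ _} (x∉ ∷ u) zero (suc j) eq = ⊥-elim (All.lookup x∉ (∈-lookup j) eq)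
lookup-injective {xs = _ ∷ _} (x∉ ∷ u) (suc i) zero eq = ⊥-elim (All.lookup x∉ (∈-lookup i) (sym eq))
lookup-injective {xs = _ ∷ _} (x∉ ∷ u) (suc i) (suc j) eq = cong suc (lookup-injective u i j eq)

listing⇒count : Listing P xs → HasCount P (length xs)
listing⇒count {xs = xs} L = lookup xs , (λ i → L .sound (∈-lookup i)) , lookup-injective (L .unique)
                , (λ a Pa → index (L .complete Pa) , sym (lookup-index (L .complete Pa)))

count-unique : HasCount P n₁ → HasCount Q n₂ → P ≐ Q → n₁ ≡ n₂
count-unique cP cQ P≐Q with xs , L , refl ← count⇒listing cP | ys , M , refl ← count⇒listing cQ =
  listing-length L M P≐Q

count-resp : P ≐ Q → HasCount P n → HasCount Q n
count-resp (P⊆Q , Q⊆P) (e , Pe , e-inj , e-onto) = e , P⊆Q ∘ Pe , e-inj , λ a → e-onto a ∘ Q⊆P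

count-image : (f : A → B) → HasCount P n → (∀ {a a'} → P a → P a' → f a ≡ f a' → a ≡ a') →
              HasCount (λ b → ∃ λ a → P a × f a ≡ b) n
count-image f (e , Pe , e-inj , e-onto) f-inj =
  f ∘ e , (λ i → e i , Pe i , refl) , (λ i j → e-inj i j ∘ f-inj (Pe i) (Pe j))
  , λ { _ (a , Pa , refl) → let i , eᵢ≡a = e-onto a Pa in i , cong f eᵢ≡a }

count-none : (∀ a → ¬ P a) → HasCount P 0
count-none ¬P = (λ ()) , (λ ()) , (λ ()) , λ a Pa → ⊥-elim (¬P a Pa)

count-if : (d : Dec B) (x : A) → HasCount (λ a → a ≡ x × B) (𝟙 d)
count-if (yes b) x = (λ _ → x) , (λ _ → refl , b) , (λ { zero zero _ → refl }) , λ { _ (refl , _) → zero , refl }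
count-if (no ¬b) x = count-none λ _ → ¬b ∘ proj₂

count-∪ : HasCount P n₁ → HasCount Q n₂ → (∀ {a} → P a → ¬ Q a) → HasCount (P ∪ Q) (n₁ + n₂)
count-∪ {P = P} {Q = Q} cP cQ disjoint with xs , L , refl ← count⇒listing cP | ys , M , refl ← count⇒listing cQ =
  subst (HasCount (P ∪ Q)) (length-++ xs) (listing⇒count L++M)
  where
  L++M : Listing (P ∪ Q) (xs ++ ys)
  L++M .unique = Unique.++⁺ (L .unique) (M .unique) λ (a∈xs , a∈ys) → disjoint (L .sound a∈xs) (M .sound a∈ys)
  L++M .complete (inj₁ Pa) = ∈-++⁺ˡ (L .complete Pa)
  L++M .complete (inj₂ Qa) = ∈-++⁺ʳ xs (M .complete Qa)
  L++M .sound a∈ with ∈-++⁻ xs a∈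
  ... | inj₁ a∈xs = inj₁ (L .sound a∈xs)
  ... | inj₂ a∈ys = inj₂ (M .sound a∈ys)

length-filter-∁ : (Q? : Decidable Q) (xs : List A) → length (filter Q? xs) + length (filter (∁? Q?) xs) ≡ length xs
length-filter-∁ Q? [] = refl
length-filter-∁ Q? (x ∷ xs) with Q? x
... | yes _ = cong suc (length-filter-∁ Q? xs)
... | no _  = trans (+-suc _ _) (cong suc (length-filter-∁ Q? xs))

listing-filter : (Q? : Decidable Q) → Listing P xs → Listing (P ∩ Q) (filter Q? xs)
listing-filter Q? L .unique = Unique.filter⁺ Q? (L .unique)
listing-filter Q? L .complete (Pa , Qa) = ∈-filter⁺ Q? (L .complete Pa) Qa
listing-filter Q? L .sound a∈ with a∈xs , Qa ← ∈-filter⁻ Q? a∈ = L .sound a∈xs , Qa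

count-split : (Q? : Decidable Q) → HasCount P n → HasCount R k → P ∩ Q ≐ R →
              ∃ λ l → HasCount (P ∩ ∁ Q) l × n ≡ k + l
count-split Q? cP cR P∩Q≐R with xs , L , refl ← count⇒listing cP =
  length (filter (∁? Q?) xs) , listing⇒count (listing-filter (∁? Q?) L) ,
  trans (sym (length-filter-∁ Q? xs))
        (cong (_+ _) (count-unique (listing⇒count (listing-filter Q? L)) cR P∩Q≐R))

-- Lists of naturals

interval : ℕ → ℕ → List ℕ
interval a = applyUpTo (_+_ a)

∈-interval⁺ : ∀ {a n x} → a ≤ x → x < a + n → x ∈ interval a n
∈-interval⁺ {a} {n} {x} a≤x x<a+n = subst (_∈ interval a n) a+[x∸a]≡x
  (∈-applyUpTo⁺ (_+_ a) (+-cancelˡ-< a _ n (subst (_< a + n) (sym a+[x∸a]≡x) x<a+n)))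
  where
  a+[x∸a]≡x : a + (x ∸ a) ≡ x
  a+[x∸a]≡x = m+[n∸m]≡n a≤x

∈-interval⁻ : ∀ {a n x} → x ∈ interval a n → a ≤ x × x < a + n
∈-interval⁻ {a} x∈ with i , i<n , refl ← ∈-applyUpTo⁻ (_+_ a) x∈ = m≤m+n a i , +-monoʳ-< a i<n

interval-sorted : ∀ a n → AllPairs _<_ (interval a n)
interval-sorted a n = AllPairsP.applyUpTo⁺₁ (_+_ a) n (λ i<j _ → +-monoʳ-< a i<j)

length-interval : ∀ a n → length (interval a n) ≡ n
length-interval a = length-applyUpTo (_+_ a)

init : List A → List A
init []           = []
init (x ∷ [])     = []
init (x ∷ y ∷ xs) = x ∷ init (y ∷ xs)

last : List ℕ → ℕ
last []           = 0
last (x ∷ [])     = x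
last (x ∷ y ∷ xs) = last (y ∷ xs)

init-∷ʳ : ∀ (xs : List A) x → init (xs ∷ʳ x) ≡ xs
init-∷ʳ []           x = refl
init-∷ʳ (y ∷ [])     x = refl
init-∷ʳ (y ∷ z ∷ xs) x = cong (y ∷_) (init-∷ʳ (z ∷ xs) x)

last-∷ʳ : ∀ xs x → last (xs ∷ʳ x) ≡ x
last-∷ʳ []           x = refl
last-∷ʳ (y ∷ [])     x = refl
last-∷ʳ (y ∷ z ∷ xs) x = last-∷ʳ (z ∷ xs) x

init-∷ʳ-last : ∀ xs → xs ≢ [] → init xs ∷ʳ last xs ≡ xs
init-∷ʳ-last []           xs≢[] = ⊥-elim (xs≢[] refl)
init-∷ʳ-last (x ∷ [])     _     = refl
init-∷ʳ-last (x ∷ y ∷ xs) _     = cong (x ∷_) (init-∷ʳ-last (y ∷ xs) λ ())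

elim-∷ʳ : (Φ : List ℕ → ℕ → List ℕ → Set) → (∀ xs x → Φ xs x (xs ∷ʳ x)) →
          ∀ xs → xs ≢ [] → Φ (init xs) (last xs) xs
elim-∷ʳ Φ φ xs xs≢[] = subst (Φ (init xs) (last xs)) (init-∷ʳ-last xs xs≢[]) (φ (init xs) (last xs))

sorted-∷ʳ⁻ : ∀ {xs x} → AllPairs _<_ (xs ∷ʳ x) → AllPairs _<_ xs × All (_< x) xs
sorted-∷ʳ⁻ {[]}     _          = [] , []
sorted-∷ʳ⁻ {y ∷ xs} (y< ∷ y<s) with xs-sorted , xs<x ← sorted-∷ʳ⁻ y<s =
  AllP.++⁻ˡ xs y< ∷ xs-sorted , All.head (AllP.++⁻ʳ xs y<) ∷ xs<x

sorted-≡ : ∀ {xs ys} → AllPairs _<_ xs → AllPairs _<_ ys →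
           (∀ {z} → z ∈ xs → z ∈ ys) → (∀ {z} → z ∈ ys → z ∈ xs) → xs ≡ ys
sorted-≡ {[]}     {[]}     _ _ _ _ = refl
sorted-≡ {[]}     {y ∷ ys} _ _ _ ys⊆xs with () ← ys⊆xs (here refl)
sorted-≡ {x ∷ xs} {[]}     _ _ xs⊆ys _ with () ← xs⊆ys (here refl)
sorted-≡ {x ∷ xs} {y ∷ ys} (x< ∷ xs<) (y< ∷ ys<) xs⊆ys ys⊆xs =
  cong₂ _∷_ x≡y (sorted-≡ xs< ys< (drop xs⊆ys x< x≡y) (drop ys⊆xs y< (sym x≡y)))
  where
  x≡y : x ≡ y
  x≡y with xs⊆ys (here refl) | ys⊆xs (here refl)
  ... | here x≡y  | _         = x≡y
  ... | there _   | here y≡x  = sym y≡x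
  ... | there y<x | there x<y = ⊥-elim (<-asym (All.lookup x< x<y) (All.lookup y< y<x))
  drop : ∀ {u us v vs} → (∀ {z} → z ∈ u ∷ us → z ∈ v ∷ vs) → All (u <_) us → u ≡ v →
         ∀ {z} → z ∈ us → z ∈ vs
  drop us⊆vs u< u≡v z∈ with us⊆vs (there z∈)
  ... | here refl = ⊥-elim (<-irrefl u≡v (All.lookup u< z∈))
  ... | there z∈vs = z∈vs

unique-⊆⇒length≤ : ∀ {xs ys : List ℕ} → Unique xs → (∀ {z} → z ∈ xs → z ∈ ys) → length xs ≤ length ys
unique-⊆⇒length≤ {[]}     _          _     = z≤n
unique-⊆⇒length≤ {x ∷ xs} {ys} (x∉ ∷ u) xs⊆ys =
  ≤-trans (s≤s (unique-⊆⇒length≤ u λ z∈ → ∈-filter⁺ (x ≢?_) (xs⊆ys (there z∈)) (All.lookup x∉ z∈)))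
          (filter-notAll (x ≢?_) ys (Any.map (λ x≡y x≢y → x≢y x≡y) (xs⊆ys (here refl))))
  where
  _≢?_ : Decidable₂ _≢_
  u ≢? v = ¬? (u ≟ v)

above : ℕ → List ℕ → ℕ
above x xs = length (filter (x <?_) xs)

above-head : ∀ {x xs} → All (x <_) xs → above x (x ∷ xs) ≡ length xs
above-head {x} x<xs = cong length (trans (filter-reject (x <?_) (<-irrefl refl)) (filter-all (x <?_) x<xs))

above-∷ : ∀ {x y xs} → y < x → above x (y ∷ xs) ≡ above x xs
above-∷ {x} y<x = cong length (filter-reject (x <?_) (<-asym y<x))

above<length : ∀ {x xs} → x ∈ xs → above x xs < length xs
above<length {x} {xs} x∈ = filter-notAll (x <?_) xs (Any.map (λ x≡y x<y → <-irrefl x≡y x<y) x∈)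

above-surjective : ∀ {xs b} → AllPairs _<_ xs → b < length xs → ∃ λ x → x ∈ xs × above x xs ≡ b
above-surjective {y ∷ ys} {b} (y< ∷ sorted) b≤len with b ≟ length ys
... | yes refl = y , here refl , above-head y<
... | no b≢len with x , x∈ , above≡b ← above-surjective sorted (≤∧≢⇒< (≤-pred b≤len) b≢len) =
  x , there x∈ , trans (above-∷ (All.lookup y< x∈)) above≡b

above-head≢ : ∀ {x y ys} → All (y <_) ys → x ∈ ys → above y (y ∷ ys) ≢ above x (y ∷ ys)
above-head≢ y< x∈ eq =
  <-irrefl (sym (trans (sym (above-head y<)) (trans eq (above-∷ (All.lookup y< x∈))))) (above<length x∈)

above-injective : ∀ {xs x x'} → AllPairs _<_ xs → x ∈ xs → x' ∈ xs → above x xs ≡ above x' xs → x ≡ x'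
above-injective _             (here refl) (here refl) _  = refl
above-injective (y< ∷ _)      (here refl) (there x'∈) eq = ⊥-elim (above-head≢ y< x'∈ eq)
above-injective (y< ∷ _)      (there x∈)  (here refl) eq = ⊥-elim (above-head≢ y< x∈ (sym eq))
above-injective (y< ∷ sorted) (there x∈)  (there x'∈) eq =
  above-injective sorted x∈ x'∈ (trans (sym (above-∷ (All.lookup y< x∈))) (trans eq (above-∷ (All.lookup y< x'∈))))

-- Numerical semigroups, children and efficacy

Closed : List ℕ → Set
Closed G = ∀ a b → a ∉ G → b ∉ G → a + b ∉ G

-- Closure is a finite check: if a + b is a gap c, then a ≤ c and b = c ∸ a.
ClosedBelowGaps : List ℕ → Set
ClosedBelowGaps G = All (λ c → All (λ a → a ∈ G ⊎ c ∸ a ∈ G) (upTo (suc c))) G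

Closed⇒ClosedBelowGaps : ∀ {G} → Closed G → ClosedBelowGaps G
Closed⇒ClosedBelowGaps {G} closed = All.tabulate λ c∈G → All.tabulate λ a∈ → split c∈G (≤-pred (∈-upTo⁻ a∈))
  where
  split : ∀ {a c} → c ∈ G → a ≤ c → a ∈ G ⊎ c ∸ a ∈ G
  split {a} {c} c∈G a≤c with a ∈? G | c ∸ a ∈? G
  ... | yes a∈G | _        = inj₁ a∈G
  ... | no _    | yes b∈G  = inj₂ b∈G
  ... | no a∉G  | no b∉G   = ⊥-elim (closed a (c ∸ a) a∉G b∉G (subst (_∈ G) (sym (m+[n∸m]≡n a≤c)) c∈G))

ClosedBelowGaps⇒Closed : ∀ {G} → ClosedBelowGaps G → Closed G
ClosedBelowGaps⇒Closed {G} below a b a∉G b∉G a+b∈G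
  with All.lookup (All.lookup below a+b∈G) (∈-upTo⁺ (s≤s (m≤m+n a b)))
... | inj₁ a∈G = a∉G a∈G
... | inj₂ b∈G = b∉G (subst (_∈ G) (m+n∸m≡n a b) b∈G)

isNS? : Decidable IsNS
isNS? G = allPairs? _<?_ G ×-dec ¬? (0 ∈? G) ×-dec
  map′ ClosedBelowGaps⇒Closed Closed⇒ClosedBelowGaps
       (all? (λ c → all? (λ a → a ∈? G ⊎-dec c ∸ a ∈? G) (upTo (suc c))) G)

isChild? : ∀ G → Decidable (IsChild G)
isChild? G x = all? (_<? x) G ×-dec isNS? (G ∷ʳ x)

sorted⇒≤last : ∀ {G} → AllPairs _<_ G → All (_≤ last G) G
sorted⇒≤last {[]} _ = []
sorted⇒≤last {G@(_ ∷ _)} = elim-∷ʳ (λ P f G → AllPairs _<_ G → All (_≤ f) G)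
  (λ P f sorted → AllP.++⁺ (All.map <⇒≤ (proj₂ (sorted-∷ʳ⁻ sorted))) (≤-refl ∷ [])) G λ ()

>last⇒∉ : ∀ {G x} → AllPairs _<_ G → last G < x → x ∉ G
>last⇒∉ sorted last<x x∈G = <⇒≱ last<x (All.lookup (sorted⇒≤last sorted) x∈G)

firstNonGapFrom : List ℕ → ℕ → ℕ → ℕ
firstNonGapFrom G zero    k = k
firstNonGapFrom G (suc n) k with k ∈? G
... | yes _ = firstNonGapFrom G n (suc k)
... | no _  = k

firstNonGapFrom-Mult : ∀ G n k → 1 ≤ k → (∀ j → 1 ≤ j → j < k → j ∈ G) → All (_< k + n) G →
                       Mult G (firstNonGapFrom G n k)
firstNonGapFrom-Mult G zero k 1≤k below G<k =
  1≤k , (λ k∈G → <-irrefl (sym (+-identityʳ k)) (All.lookup G<k k∈G)) , below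
firstNonGapFrom-Mult G (suc n) k 1≤k below G<k+n with k ∈? G
... | no k∉G = 1≤k , k∉G , below
... | yes k∈G =
  firstNonGapFrom-Mult G n (suc k) (s≤s z≤n) below′ (All.map (λ {x} → subst (x <_) (+-suc k n)) G<k+n)
  where
  below′ : ∀ j → 1 ≤ j → j < suc k → j ∈ G
  below′ j 1≤j j≤k with j ≟ k
  ... | yes refl = k∈G
  ... | no j≢k = below j 1≤j (≤∧≢⇒< (≤-pred j≤k) j≢k)

mult : List ℕ → ℕ
mult G = firstNonGapFrom G (last G) 1

mult-Mult : ∀ {G} → AllPairs _<_ G → Mult G (mult G)
mult-Mult {G} sorted = firstNonGapFrom-Mult G (last G) 1 (s≤s z≤n) (λ j 1≤j j<1 → ⊥-elim (<⇒≱ j<1 1≤j))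
  (All.map s≤s (sorted⇒≤last sorted))

Mult-unique : ∀ {G m m'} → Mult G m → Mult G m' → m ≡ m'
Mult-unique {m = m} {m'} (1≤m , m∉G , below) (1≤m' , m'∉G , below') with <-cmp m m'
... | tri< m<m' _ _ = ⊥-elim (m∉G (below' m 1≤m m<m'))
... | tri≈ _ m≡m' _ = m≡m'
... | tri> _ _ m'<m = ⊥-elim (m'∉G (below m' 1≤m' m'<m))

last∈ : ∀ {G} → G ≢ [] → last G ∈ G
last∈ {G} = elim-∷ʳ (λ P f G → f ∈ G) (λ P f → ∈-++⁺ʳ P (here refl)) G

∉-∷ʳ⁺ : ∀ {a} (P : List ℕ) f → a ∉ P → a ≢ f → a ∉ P ∷ʳ f
∉-∷ʳ⁺ P f a∉P a≢f a∈ with ∈-++⁻ P a∈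
... | inj₁ a∈P = a∉P a∈P
... | inj₂ (here a≡f) = a≢f a≡f

Irreducible : List ℕ → ℕ → Set
Irreducible G y = ∀ a b → a ∉ G → b ∉ G → 1 ≤ a → 1 ≤ b → a + b ≢ y

-- If y > f + m, then y = m + (y ∸ m) with y ∸ m > f a non-gap.
irreducible⇒≤last+mult : ∀ {G y} → AllPairs _<_ G → Irreducible G y → y ≤ last G + mult G
irreducible⇒≤last+mult {G} {y} sorted irreducible with y ≤? last G + mult G
... | yes y≤ = y≤
... | no y≰ = ⊥-elim (irreducible m (y ∸ m) m∉G (>last⇒∉ sorted last<y∸m) 1≤m (≤-trans (s≤s z≤n) last<y∸m)
                                 (m+[n∸m]≡n m≤y))
  where
  m : ℕ
  m = mult G
  1≤m : 1 ≤ m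
  1≤m = proj₁ (mult-Mult sorted)
  m∉G : m ∉ G
  m∉G = proj₁ (proj₂ (mult-Mult sorted))
  last+m<y : last G + m < y
  last+m<y = ≰⇒> y≰
  m≤y : m ≤ y
  m≤y = ≤-trans (m≤n+m m (last G)) (<⇒≤ last+m<y)
  last<y∸m : last G < y ∸ m
  last<y∸m = +-cancelʳ-< m (last G) (y ∸ m) (subst (last G + m <_) (sym (m∸n+n≡m m≤y)) last+m<y)

IsChild⇒ : ∀ {G y} → IsChild G y → All (_< y) G × 1 ≤ y × Irreducible G y
IsChild⇒ {G} {y} (G<y , _ , 0∉ , closed) = G<y , 1≤y , irreducible
  where
  y∈ : y ∈ G ∷ʳ y
  y∈ = ∈-++⁺ʳ G (here refl)
  1≤y : 1 ≤ y
  1≤y = n≢0⇒n>0 λ y≡0 → 0∉ (subst (_∈ G ∷ʳ y) y≡0 y∈)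
  irreducible : Irreducible G y
  irreducible a b a∉ b∉ 1≤a 1≤b a+b≡y = closed a b
    (∉-∷ʳ⁺ G y a∉ (<⇒≢ (subst (a <_) a+b≡y (m<m+n a 1≤b))))
    (∉-∷ʳ⁺ G y b∉ (<⇒≢ (subst (b <_) a+b≡y (m<n+m b 1≤a))))
    (subst (_∈ G ∷ʳ y) (sym a+b≡y) y∈)

IsChild⇐ : ∀ {G y} → IsNS G → All (_< y) G → 1 ≤ y → Irreducible G y → IsChild G y
IsChild⇐ {G} {y} (sorted , 0∉G , closed) G<y 1≤y irreducible =
  G<y , AllPairsP.++⁺ sorted ([] ∷ []) (All.map (_∷ []) G<y) , ∉-∷ʳ⁺ G y 0∉G (<⇒≢ 1≤y) , closed′
  where
  sum≢y : ∀ a b → a ∉ G ∷ʳ y → b ∉ G ∷ʳ y → a + b ≢ y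
  sum≢y zero        b         _  b∉ b≡y   = b∉ (∈-++⁺ʳ G (here b≡y))
  sum≢y a@(suc _)   zero      a∉ _  a+0≡y = a∉ (∈-++⁺ʳ G (here (trans (sym (+-identityʳ a)) a+0≡y)))
  sum≢y a@(suc _)   b@(suc _) a∉ b∉       = irreducible a b (a∉ ∘ ∈-++⁺ˡ) (b∉ ∘ ∈-++⁺ˡ) (s≤s z≤n) (s≤s z≤n)
  closed′ : Closed (G ∷ʳ y)
  closed′ a b a∉ b∉ a+b∈ with ∈-++⁻ G a+b∈
  ... | inj₁ a+b∈G        = closed a b (a∉ ∘ ∈-++⁺ˡ) (b∉ ∘ ∈-++⁺ˡ) a+b∈G
  ... | inj₂ (here a+b≡y) = sum≢y a b a∉ b∉ a+b≡y

-- Children lie in (f, f + m]. For G = [] (ℕ₀, with f = −1) the junk value last [] = 0 still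
-- gives the right interval {1}.
candidates : List ℕ → List ℕ
candidates G = interval (suc (last G)) (mult G)

children : List ℕ → List ℕ
children G = filter (isChild? G) (candidates G)

child∈candidates : ∀ {G y} → IsNS G → IsChild G y → y ∈ candidates G
child∈candidates {G} {y} (sorted , _) child with G<y , 1≤y , irreducible ← IsChild⇒ child =
  ∈-interval⁺ (last<y G G<y) (s≤s (irreducible⇒≤last+mult sorted irreducible))
  where
  last<y : ∀ G → All (_< y) G → last G < y
  last<y []          _   = 1≤y
  last<y G@(_ ∷ _)   G<y = All.lookup G<y (last∈ {G} λ ())

children-listing : ∀ {G} → IsNS G → Listing (IsChild G) (children G)
children-listing {G} ns .unique =
  Unique.filter⁺ (isChild? G) (AllPairs.map <⇒≢ (interval-sorted (suc (last G)) (mult G)))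
children-listing {G} ns .complete child = ∈-filter⁺ (isChild? G) (child∈candidates ns child) child
children-listing {G} ns .sound y∈ = proj₂ (∈-filter⁻ (isChild? G) {xs = candidates G} y∈)

children-sorted : ∀ G → AllPairs _<_ (children G)
children-sorted G = AllPairsP.filter⁺ (isChild? G) (interval-sorted (suc (last G)) (mult G))

efficacy : List ℕ → ℕ
efficacy G = length (children G)

efficacy≤mult : ∀ G → efficacy G ≤ mult G
efficacy≤mult G =
  ≤-trans (length-filter (isChild? G) (candidates G)) (≤-reflexive (length-interval (suc (last G)) (mult G)))

Efficacy-efficacy : ∀ {G} → IsNS G → Efficacy G (efficacy G)
Efficacy-efficacy ns = listing⇒count (children-listing ns)

Efficacy⇒≡efficacy : ∀ {G n} → IsNS G → Efficacy G n → n ≡ efficacy G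
Efficacy⇒≡efficacy ns eff = count-unique eff (Efficacy-efficacy ns) (id , id)

non-child⇒efficacy<mult : ∀ {G y} → y ∈ candidates G → ¬ IsChild G y → efficacy G < mult G
non-child⇒efficacy<mult {G} y∈ ¬child = ≤-trans
  (filter-notAll (isChild? G) (candidates G) (Any.map (λ { refl → ¬child }) y∈))
  (≤-reflexive (length-interval (suc (last G)) (mult G)))

below-mult⇒∈ : ∀ {G x} → AllPairs _<_ G → x ∈ interval 1 (mult G ∸ 1) → x ∈ G
below-mult⇒∈ {G} sorted x∈ with 1≤x , x<1+[m∸1] ← ∈-interval⁻ x∈ | 1≤m , _ , below ← mult-Mult sorted =
  below _ 1≤x (subst (_ <_) (m+[n∸m]≡n 1≤m) x<1+[m∸1])

Descends : List ℕ → Set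
Descends G = IsChild G (mult G + last G)

descends? : Decidable Descends
descends? G = isChild? G (mult G + last G)

Ordinary : List ℕ → Set
Ordinary G = last G < mult G

ordinary? : Decidable Ordinary
ordinary? G = last G <? mult G

rank : List ℕ → ℕ
rank G = above (last G) (children (init G))

ordinary : ℕ → List ℕ
ordinary g = interval 1 g

genus-ordinary : ∀ g → genus (ordinary g) ≡ g
genus-ordinary = length-interval 1

ordinary-isNS : ∀ g → IsNS (ordinary g)
ordinary-isNS g = interval-sorted 1 g , (λ 0∈ → <-irrefl refl (proj₁ (∈-interval⁻ 0∈))) , closed
  where
  closed : Closed (ordinary g)
  closed zero    b _  b∉ b∈ = b∉ b∈
  closed (suc a) b a∉ _  a+b∈ =
    a∉ (∈-interval⁺ (s≤s z≤n) (≤-<-trans (m≤m+n (suc a) b) (proj₂ (∈-interval⁻ a+b∈))))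

last-ordinary : ∀ g → last (ordinary g) ≡ g
last-ordinary zero = refl
last-ordinary (suc g) = ≤-antisym (≤-pred (proj₂ (∈-interval⁻ (last∈ {ordinary (suc g)} λ ()))))
  (All.lookup (sorted⇒≤last (interval-sorted 1 (suc g))) (∈-interval⁺ (s≤s z≤n) ≤-refl))

mult-ordinary : ∀ g → mult (ordinary g) ≡ suc g
mult-ordinary g = Mult-unique (mult-Mult (interval-sorted 1 g))
  (s≤s z≤n , (λ suc-g∈ → <-irrefl refl (proj₂ (∈-interval⁻ suc-g∈))) , λ _ 1≤j j<1+g → ∈-interval⁺ 1≤j j<1+g)

ordinary-Ordinary : ∀ g → Ordinary (ordinary g)
ordinary-Ordinary g = subst₂ _<_ (sym (last-ordinary g)) (sym (mult-ordinary g)) ≤-refl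

efficacy-ordinary : ∀ g → efficacy (ordinary g) ≡ suc g
efficacy-ordinary g = begin
  length (filter (isChild? (ordinary g)) (candidates (ordinary g)))
    ≡⟨ cong length (filter-all (isChild? _) all-children) ⟩
  length (candidates (ordinary g))
    ≡⟨ length-interval _ _ ⟩
  mult (ordinary g)
    ≡⟨ mult-ordinary g ⟩
  suc g
    ∎
  where
  open ≡-Reasoning
  child : ∀ {y} → g < y → y ≤ g + suc g → IsChild (ordinary g) y
  child {y} g<y y≤2g+1 = IsChild⇐ (ordinary-isNS g)
    (All.tabulate λ x∈ → <-≤-trans (proj₂ (∈-interval⁻ x∈)) g<y) (≤-trans (s≤s z≤n) g<y) irreducible
    where
    nongap>g : ∀ {a} → a ∉ ordinary g → 1 ≤ a → g < a
    nongap>g a∉ 1≤a = ≰⇒> λ a≤g → a∉ (∈-interval⁺ 1≤a (s≤s a≤g))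
    irreducible : Irreducible (ordinary g) y
    irreducible a b a∉ b∉ 1≤a 1≤b a+b≡y =
      <⇒≱ (+-mono-≤ (nongap>g a∉ 1≤a) (nongap>g b∉ 1≤b)) (subst (_≤ g + suc g) (sym a+b≡y) y≤2g+1)
  all-children : All (IsChild (ordinary g)) (candidates (ordinary g))
  all-children = All.tabulate λ y∈ → let last<y , y<last+mult = ∈-interval⁻ y∈ in
    child (subst (_< _) (last-ordinary g) last<y)
          (≤-pred (subst₂ (λ l m → _ < suc l + m) (last-ordinary g) (mult-ordinary g) y<last+mult))

∷ʳ≢[] : ∀ (xs : List A) x → xs ∷ʳ x ≢ []
∷ʳ≢[] []      _ ()
∷ʳ≢[] (_ ∷ _) _ ()

-- Removing the Frobenius number

-- The semigroup with gaps P ∷ʳ f is its parent, with gaps P, minus the Frobenius number f.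
module Frobenius {P : List ℕ} {f : ℕ} (ns : IsNS (P ∷ʳ f)) where

  private
    G : List ℕ
    G = P ∷ʳ f
    m : ℕ
    m = mult G
    sorted : AllPairs _<_ G
    sorted = proj₁ ns
    1≤m : 1 ≤ m
    1≤m = proj₁ (mult-Mult sorted)
    m∉G : m ∉ G
    m∉G = proj₁ (proj₂ (mult-Mult sorted))

  P<f : All (_< f) P
  P<f = proj₂ (sorted-∷ʳ⁻ sorted)

  f∈G : f ∈ G
  f∈G = ∈-++⁺ʳ P (here refl)

  f∉P : f ∉ P
  f∉P f∈P = <-irrefl refl (All.lookup P<f f∈P)

  1≤f : 1 ≤ f
  1≤f = n≢0⇒n>0 λ f≡0 → proj₁ (proj₂ ns) (subst (_∈ G) f≡0 f∈G)

  ≤f : ∀ {x} → x ∈ G → x ≤ f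
  ≤f x∈G with ∈-++⁻ P x∈G
  ... | inj₁ x∈P       = <⇒≤ (All.lookup P<f x∈P)
  ... | inj₂ (here refl) = ≤-refl

  G<y : ∀ {y} → f < y → All (_< y) G
  G<y f<y = All.tabulate λ x∈G → ≤-<-trans (≤f x∈G) f<y

  m≢f : m ≢ f
  m≢f m≡f = m∉G (subst (_∈ G) (sym m≡f) f∈G)

  nongap⇒≥m : ∀ {b} → b ∉ G → 1 ≤ b → m ≤ b
  nongap⇒≥m {b} b∉G 1≤b = ≮⇒≥ λ b<m → b∉G (proj₂ (proj₂ (mult-Mult sorted)) b 1≤b b<m)

  irreducible⇒≤f+m : ∀ {y} → Irreducible G y → y ≤ f + m
  irreducible⇒≤f+m irreducible = subst (λ l → _ ≤ l + m) (last-∷ʳ P f) (irreducible⇒≤last+mult sorted irreducible)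

  parent-isNS : IsNS P
  parent-isNS = proj₁ (sorted-∷ʳ⁻ sorted) , proj₁ (proj₂ ns) ∘ ∈-++⁺ˡ , closed
    where
    closed : Closed P
    closed a b a∉P b∉P a+b∈P with a ≟ f | b ≟ f
    ... | yes refl | _        = <⇒≱ (All.lookup P<f a+b∈P) (m≤m+n a b)
    ... | no _     | yes refl = <⇒≱ (All.lookup P<f a+b∈P) (m≤n+m b a)
    ... | no a≢f   | no b≢f   = proj₂ (proj₂ ns) a b (∉-∷ʳ⁺ P f a∉P a≢f) (∉-∷ʳ⁺ P f b∉P b≢f) (∈-++⁺ˡ a+b∈P)

  f-child-of-parent : IsChild P f
  f-child-of-parent = P<f , ns

  -- If b ≠ f, then b is a non-gap of G, so b ≥ m: b = m yields m + f, and b > m yields y > f + m.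
  f+b-reducible : ∀ {y b} → Irreducible G y → y ≢ m + f → y ≢ f + f → b ∉ P → 1 ≤ b → f + b ≢ y
  f+b-reducible {y} {b} irreducible y≢m+f y≢f+f b∉P 1≤b f+b≡y with b ≟ f | b ≟ m
  ... | yes refl | _        = y≢f+f (sym f+b≡y)
  ... | no _     | yes refl = y≢m+f (trans (sym f+b≡y) (+-comm f m))
  ... | no b≢f   | no b≢m   = <⇒≱ (subst (f + m <_) f+b≡y (+-monoʳ-< f m<b)) (irreducible⇒≤f+m irreducible)
    where
    m<b : m < b
    m<b = ≤∧≢⇒< (nongap⇒≥m (∉-∷ʳ⁺ P f b∉P b≢f) 1≤b) (b≢m ∘ sym)

  irreducible-in-parent : ∀ {y} → Irreducible G y → y ≢ m + f → y ≢ f + f → Irreducible P y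
  irreducible-in-parent irreducible y≢m+f y≢f+f a b a∉P b∉P 1≤a 1≤b a+b≡y with a ≟ f | b ≟ f
  ... | yes refl | _        = f+b-reducible irreducible y≢m+f y≢f+f b∉P 1≤b a+b≡y
  ... | no _     | yes refl = f+b-reducible irreducible y≢m+f y≢f+f a∉P 1≤a (trans (+-comm f a) a+b≡y)
  ... | no a≢f   | no b≢f   = irreducible a b (∉-∷ʳ⁺ P f a∉P a≢f) (∉-∷ʳ⁺ P f b∉P b≢f) 1≤a 1≤b a+b≡y

  f<m⇒f+f-child : f < m → IsChild G (f + f)
  f<m⇒f+f-child f<m = IsChild⇐ ns (G<y (m<m+n f 1≤f)) (≤-trans 1≤f (m≤m+n f f)) λ a b a∉G b∉G 1≤a 1≤b a+b≡f+f →
    <-irrefl (sym a+b≡f+f) (+-mono-< (<-≤-trans f<m (nongap⇒≥m a∉G 1≤a)) (<-≤-trans f<m (nongap⇒≥m b∉G 1≤b)))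

  f+f-child⇒f<m : IsChild G (f + f) → f < m
  f+f-child⇒f<m child with <-cmp f m
  ... | tri< f<m _ _ = f<m
  ... | tri≈ _ f≡m _ = ⊥-elim (m≢f (sym f≡m))
  ... | tri> _ _ m<f = ⊥-elim (<⇒≱ (+-monoʳ-< f m<f) (irreducible⇒≤f+m (proj₂ (proj₂ (IsChild⇒ child)))))

  f<m⇒m+f-child : f < m → IsChild G (m + f)
  f<m⇒m+f-child f<m = IsChild⇐ ns (G<y (m<n+m f 1≤m)) (≤-trans 1≤m (m≤m+n m f)) λ a b a∉G b∉G 1≤a 1≤b a+b≡m+f →
    <-irrefl (sym a+b≡m+f) (+-mono-≤-< (nongap⇒≥m a∉G 1≤a) (<-≤-trans f<m (nongap⇒≥m b∉G 1≤b)))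

  NewChild : ℕ → Set
  NewChild = (λ y → y ≡ m + f × IsChild G (m + f)) ∪ (λ y → y ≡ f + f × f < m)

  children-∷ʳ : IsChild G ≐ NewChild ∪ (IsChild P ∩ (f <_))
  children-∷ʳ = to , from
    where
    to : IsChild G ⊆ NewChild ∪ (IsChild P ∩ (f <_))
    to {y} child with G<y′ , 1≤y , irreducible ← IsChild⇒ child | y ≟ m + f | y ≟ f + f
    ... | yes refl | _        = inj₁ (inj₁ (refl , child))
    ... | no _     | yes refl = inj₁ (inj₂ (refl , f+f-child⇒f<m child))
    ... | no y≢m+f | no y≢f+f = inj₂ (IsChild⇐ parent-isNS (AllP.++⁻ˡ P G<y′) 1≤y
                                         (irreducible-in-parent irreducible y≢m+f y≢f+f)
                                      , All.lookup G<y′ f∈G)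
    from : NewChild ∪ (IsChild P ∩ (f <_)) ⊆ IsChild G
    from (inj₁ (inj₁ (refl , child))) = child
    from (inj₁ (inj₂ (refl , f<m)))   = f<m⇒f+f-child f<m
    from (inj₂ (child , f<y)) with _ , 1≤y , irreducible ← IsChild⇒ child =
      IsChild⇐ ns (G<y f<y) 1≤y λ a b a∉G b∉G → irreducible a b (a∉G ∘ ∈-++⁺ˡ) (b∉G ∘ ∈-++⁺ˡ)

  efficacy-∷ʳ : efficacy G ≡ (𝟙 (isChild? G (m + f)) + 𝟙 (f <? m)) + above f (children P)
  efficacy-∷ʳ = count-unique (Efficacy-efficacy ns)
    (count-∪ (count-∪ (count-if (isChild? G (m + f)) (m + f)) (count-if (f <? m) (f + f)) m+f≢f+f)
             (listing⇒count (listing-filter (f <?_) (children-listing parent-isNS)))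
             not-parent-child)
    children-∷ʳ
    where
    m+f≢f+f : ∀ {y} → y ≡ m + f × IsChild G (m + f) → ¬ (y ≡ f + f × f < m)
    m+f≢f+f (refl , _) (m+f≡f+f , _) = m≢f (+-cancelʳ-≡ f m f m+f≡f+f)
    not-parent-child : ∀ {y} → NewChild y → ¬ (IsChild P y × f < y)
    not-parent-child (inj₁ (refl , _)) (child , _) =
      proj₂ (proj₂ (IsChild⇒ child)) m f (m∉G ∘ ∈-++⁺ˡ) f∉P 1≤m 1≤f refl
    not-parent-child (inj₂ (refl , _)) (child , _) =
      proj₂ (proj₂ (IsChild⇒ child)) f f f∉P f∉P 1≤f 1≤f refl

  StronglyDescended⇔ : StronglyDescended G ⇔ IsChild G (m + f)
  StronglyDescended⇔ = mk⇔ to from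
    where
    to : StronglyDescended G → IsChild G (m + f)
    to (inj₁ G≡[]) = ⊥-elim (∷ʳ≢[] P f G≡[])
    to (inj₂ (m′ , f′ , mult′ , (f′∈G , G≤f′) , ns′)) =
      G<y (m<n+m f 1≤m) , subst₂ (λ a b → IsNS (G ∷ʳ (a + b))) (Mult-unique mult′ (mult-Mult sorted)) f′≡f ns′
      where
      f′≡f : f′ ≡ f
      f′≡f = ≤-antisym (≤f f′∈G) (All.lookup G≤f′ f∈G)
    from : IsChild G (m + f) → StronglyDescended G
    from child = inj₂ (m , f , mult-Mult sorted , (f∈G , All.tabulate ≤f) , proj₂ child)

  Ordinary⇒≡ordinary : f < m → G ≡ ordinary (genus G)
  Ordinary⇒≡ordinary f<m = trans G≡ (cong (interval 1) (trans (sym (length-interval 1 (m ∸ 1))) (cong length (sym G≡))))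
    where
    G≡ : G ≡ interval 1 (m ∸ 1)
    G≡ = sorted-≡ sorted (interval-sorted 1 (m ∸ 1))
      (λ {x} x∈G → ∈-interval⁺ (n≢0⇒n>0 λ x≡0 → proj₁ (proj₂ ns) (subst (_∈ G) x≡0 x∈G))
                                (subst (x <_) (sym (m+[n∸m]≡n 1≤m)) (≤-<-trans (≤f x∈G) f<m)))
      (below-mult⇒∈ sorted)

  gaps-bound : ∀ xs → Unique xs → All (m ≤_) xs → All (_∈ G) xs → length xs + (m ∸ 1) ≤ genus G
  gaps-bound xs unique xs≥m xs⊆G =
    subst (_≤ genus G) (trans (length-++ xs) (cong (_+_ (length xs)) (length-interval 1 (m ∸ 1))))
      (unique-⊆⇒length≤ (Unique.++⁺ unique (AllPairs.map <⇒≢ (interval-sorted 1 (m ∸ 1))) disjoint) ⊆G)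
    where
    disjoint : ∀ {x} → ¬ (x ∈ xs × x ∈ interval 1 (m ∸ 1))
    disjoint (x∈xs , x∈) = <⇒≱ (subst (_ <_) (m+[n∸m]≡n 1≤m) (proj₂ (∈-interval⁻ x∈))) (All.lookup xs≥m x∈xs)
    ⊆G : ∀ {x} → x ∈ xs ++ interval 1 (m ∸ 1) → x ∈ G
    ⊆G x∈ with ∈-++⁻ xs x∈
    ... | inj₁ x∈xs = All.lookup xs⊆G x∈xs
    ... | inj₂ x∈   = below-mult⇒∈ sorted x∈

  -- If f < 2m, then 2m is a candidate but not a child, so h < m ≤ g. Otherwise f > 2m, and f ∸ m
  -- must be a gap, so g ≥ m + 1 > h.
  m<f⇒efficacy<genus : m < f → efficacy G < genus G
  m<f⇒efficacy<genus m<f with f <? m + m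
  ... | yes f<m+m = <-≤-trans (non-child⇒efficacy<mult m+m-candidate m+m-not-child)
                              (subst (_≤ genus G) (m+[n∸m]≡n 1≤m)
                                (gaps-bound [ f ] ([] ∷ []) (<⇒≤ m<f ∷ []) (f∈G ∷ [])))
    where
    m+m-candidate : m + m ∈ candidates G
    m+m-candidate = ∈-interval⁺ (subst (_< m + m) (sym (last-∷ʳ P f)) f<m+m)
                                (s≤s (subst (λ l → m + m ≤ l + m) (sym (last-∷ʳ P f)) (+-monoˡ-≤ m (<⇒≤ m<f))))
    m+m-not-child : ¬ IsChild G (m + m)
    m+m-not-child child = proj₂ (proj₂ (IsChild⇒ child)) m m m∉G m∉G 1≤m 1≤m refl
  ... | no f≮m+m = <-≤-trans (s≤s (efficacy≤mult G))
                             (subst (_≤ genus G) (cong suc (m+[n∸m]≡n 1≤m))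
                               (gaps-bound (d ∷ f ∷ []) d,f-unique (<⇒≤ m<d ∷ <⇒≤ m<f ∷ []) (d∈G ∷ f∈G ∷ [])))
    where
    closed : Closed G
    closed = proj₂ (proj₂ ns)
    m+m<f : m + m < f
    m+m<f = ≤∧≢⇒< (≮⇒≥ f≮m+m) λ m+m≡f → closed m m m∉G m∉G (subst (_∈ G) (sym m+m≡f) f∈G)
    d : ℕ
    d = f ∸ m
    m+d≡f : m + d ≡ f
    m+d≡f = m+[n∸m]≡n (<⇒≤ m<f)
    m<d : m < d
    m<d = +-cancelˡ-< m m d (subst (m + m <_) (sym m+d≡f) m+m<f)
    d<f : d < f
    d<f = subst (d <_) (trans (+-comm d m) m+d≡f) (m<m+n d 1≤m)
    d∈G : d ∈ G
    d∈G with d ∈? G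
    ... | yes d∈G = d∈G
    ... | no d∉G  = ⊥-elim (closed m d m∉G d∉G (subst (_∈ G) (sym m+d≡f) f∈G))
    d,f-unique : Unique (d ∷ f ∷ [])
    d,f-unique = (<⇒≢ d<f ∷ []) ∷ [] ∷ []

  efficacy≢genus : efficacy G ≢ genus G
  efficacy≢genus with <-cmp f m
  ... | tri< f<m _ _ = λ eff≡genus → <-irrefl (sym eff≡genus)
    (subst (λ X → genus G < efficacy X) (sym (Ordinary⇒≡ordinary f<m))
      (subst (genus G <_) (sym (efficacy-ordinary (genus G))) ≤-refl))
  ... | tri≈ _ f≡m _ = ⊥-elim (m≢f (sym f≡m))
  ... | tri> _ _ m<f = <⇒≢ (m<f⇒efficacy<genus m<f)

module _ {G} (ns : IsNS G) (G≢[] : G ≢ []) where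

  efficacy≡rank+ : efficacy G ≡ (𝟙 (descends? G) + 𝟙 (ordinary? G)) + rank G
  efficacy≡rank+ = elim-∷ʳ
    (λ P f G → IsNS G → efficacy G ≡ (𝟙 (isChild? G (mult G + f)) + 𝟙 (f <? mult G)) + above f (children P))
    (λ _ _ → Frobenius.efficacy-∷ʳ) G G≢[] ns

  StronglyDescended⇔Descends : StronglyDescended G ⇔ Descends G
  StronglyDescended⇔Descends = elim-∷ʳ
    (λ P f G → IsNS G → StronglyDescended G ⇔ IsChild G (mult G + f))
    (λ _ _ → Frobenius.StronglyDescended⇔) G G≢[] ns

  Ordinary⇒Descends : Ordinary G → Descends G
  Ordinary⇒Descends = elim-∷ʳ
    (λ P f G → IsNS G → f < mult G → IsChild G (mult G + f))
    (λ _ _ → Frobenius.f<m⇒m+f-child) G G≢[] ns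

  Ordinary⇒≡ordinary : Ordinary G → G ≡ ordinary (genus G)
  Ordinary⇒≡ordinary = elim-∷ʳ
    (λ P f G → IsNS G → f < mult G → G ≡ ordinary (genus G))
    (λ _ _ → Frobenius.Ordinary⇒≡ordinary) G G≢[] ns

  efficacy≢genus : efficacy G ≢ genus G
  efficacy≢genus = elim-∷ʳ (λ P f G → IsNS G → efficacy G ≢ genus G) (λ _ _ → Frobenius.efficacy≢genus) G G≢[] ns

  parent-isNS : IsNS (init G)
  parent-isNS = elim-∷ʳ (λ P f G → IsNS G → IsNS P) (λ _ _ → Frobenius.parent-isNS) G G≢[] ns

  last-child-of-parent : IsChild (init G) (last G)
  last-child-of-parent = elim-∷ʳ (λ P f G → IsNS G → IsChild P f) (λ _ _ → Frobenius.f-child-of-parent) G G≢[] ns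

  rank-cases : ∀ {b} → rank G ≡ b ⇔ (efficacy G ≡ b × ¬ Descends G
                                     ⊎ efficacy G ≡ suc b × Descends G × ¬ Ordinary G
                                     ⊎ efficacy G ≡ suc (suc b) × Ordinary G)
  rank-cases = cases (descends? G) (ordinary? G) efficacy≡rank+
    where
    cases : ∀ {b} (d : Dec (Descends G)) (o : Dec (Ordinary G)) → efficacy G ≡ (𝟙 d + 𝟙 o) + rank G →
            rank G ≡ b ⇔ (efficacy G ≡ b × ¬ Descends G
                          ⊎ efficacy G ≡ suc b × Descends G × ¬ Ordinary G
                          ⊎ efficacy G ≡ suc (suc b) × Ordinary G)
    cases (no ¬d) (yes o) _  = ⊥-elim (¬d (Ordinary⇒Descends o))
    cases (no ¬d) (no ¬o) eq = mk⇔ (λ r≡b → inj₁ (trans eq r≡b , ¬d)) λ where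
      (inj₁ (e≡b , _))          → trans (sym eq) e≡b
      (inj₂ (inj₁ (_ , d , _))) → ⊥-elim (¬d d)
      (inj₂ (inj₂ (_ , o)))     → ⊥-elim (¬o o)
    cases (yes d) (no ¬o) eq = mk⇔ (λ r≡b → inj₂ (inj₁ (trans eq (cong suc r≡b) , d , ¬o))) λ where
      (inj₁ (_ , ¬d))            → ⊥-elim (¬d d)
      (inj₂ (inj₁ (e≡1+b , _))) → suc-injective (trans (sym eq) e≡1+b)
      (inj₂ (inj₂ (_ , o)))      → ⊥-elim (¬o o)
    cases (yes d) (yes o) eq = mk⇔ (λ r≡b → inj₂ (inj₂ (trans eq (cong (_+_ 2) r≡b) , o))) λ where
      (inj₁ (_ , ¬d))             → ⊥-elim (¬d d)
      (inj₂ (inj₁ (_ , _ , ¬o))) → ⊥-elim (¬o o)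
      (inj₂ (inj₂ (e≡2+b , _)))  → suc-injective (suc-injective (trans (sym eq) e≡2+b))

-- The recurrence

NSgh-intro : ∀ {g b G} → IsNS G → genus G ≡ g → efficacy G ≡ b → NSgh g b G
NSgh-intro ns gen eff = ns , gen , subst (Efficacy _) eff (Efficacy-efficacy ns)

NSgh⇒efficacy : ∀ {g b G} → NSgh g b G → efficacy G ≡ b
NSgh⇒efficacy (ns , _ , eff) = sym (Efficacy⇒≡efficacy ns eff)

genus-∷ʳ : ∀ (P : List ℕ) x → genus (P ∷ʳ x) ≡ suc (genus P)
genus-∷ʳ P x = trans (length-++ P) (+-comm (length P) 1)

NSrank : ℕ → ℕ → List ℕ → Set
NSrank g b G = IsNS G × genus G ≡ g × rank G ≡ b

NSpredAbove : ℕ → ℕ → List ℕ → Set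
NSpredAbove g b P = IsNS P × suc (genus P) ≡ g × b < efficacy P

NSpredAbove∩≡≐NSpred : ∀ {g b} → NSpredAbove g b ∩ (λ P → efficacy P ≡ suc b) ≐ NSpred g (suc b)
NSpredAbove∩≡≐NSpred =
  (λ ((ns , gen , _) , eff≡) → ns , gen , subst (Efficacy _) eff≡ (Efficacy-efficacy ns)) ,
  (λ (ns , gen , eff) → let eff≡ = sym (Efficacy⇒≡efficacy ns eff) in
                         (ns , gen , subst (_ <_) (sym eff≡) ≤-refl) , eff≡)

NSpredAbove∩≢≐NSpredAbove : ∀ {g b} → NSpredAbove g b ∩ ∁ (λ P → efficacy P ≡ suc b) ≐ NSpredAbove g (suc b)
NSpredAbove∩≢≐NSpredAbove =
  (λ ((ns , gen , b<eff) , eff≢) → ns , gen , ≤∧≢⇒< b<eff (eff≢ ∘ sym)) ,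
  (λ (ns , gen , 1+b<eff) → (ns , gen , <⇒≤ 1+b<eff) , λ eff≡ → <-irrefl (sym eff≡) 1+b<eff)

shat≡ : ∀ g h s → (g ≡ h → s ≡ 0) → shat g h s ≡ s + 𝟙 (g ≟ h)
shat≡ g h s s≡0 with g ≟ h
... | yes g≡h = cong (_+ 1) (sym (s≡0 g≡h))
... | no _    = sym (+-identityʳ s)

add-sub : ∀ x y → x ≡ (x +ℤ y) - y
add-sub = ℤ-Solver.solve-∀

move-sub : ∀ x z y → (x +ℤ z) - y ≡ x - y +ℤ z
move-sub = ℤ-Solver.solve-∀

ℕ-identity⇒ℤ : ∀ {t₀ t₁ tp a b c} → t₀ + 2 * b ≡ t₁ + tp + a + c →
               + t₀ ≡ ((+ t₁ +ℤ + tp) +ℤ + a) - (+ 2 *ℤ + b) +ℤ + c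
ℕ-identity⇒ℤ {t₀} {t₁} {tp} {a} {b} {c} eq = begin
  + t₀                                            ≡⟨ add-sub (+ t₀) (+ 2 *ℤ + b) ⟩
  (+ t₀ +ℤ + 2 *ℤ + b) - (+ 2 *ℤ + b)             ≡⟨ cong (_- (+ 2 *ℤ + b)) lifted ⟩
  (((+ t₁ +ℤ + tp) +ℤ + a) +ℤ + c) - (+ 2 *ℤ + b) ≡⟨ move-sub ((+ t₁ +ℤ + tp) +ℤ + a) (+ c) (+ 2 *ℤ + b) ⟩
  ((+ t₁ +ℤ + tp) +ℤ + a) - (+ 2 *ℤ + b) +ℤ + c   ∎
  where
  open ≡-Reasoning
  lifted : + t₀ +ℤ + 2 *ℤ + b ≡ ((+ t₁ +ℤ + tp) +ℤ + a) +ℤ + c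
  lifted = begin
    + t₀ +ℤ + 2 *ℤ + b              ≡⟨ cong (+ t₀ +ℤ_) (pos-* 2 b) ⟨
    + t₀ +ℤ + (2 * b)               ≡⟨ pos-+ t₀ (2 * b) ⟨
    + (t₀ + 2 * b)                  ≡⟨ cong +_ eq ⟩
    + (t₁ + tp + a + c)             ≡⟨ pos-+ (t₁ + tp + a) c ⟩
    + (t₁ + tp + a) +ℤ + c          ≡⟨ cong (_+ℤ + c) (pos-+ (t₁ + tp) a) ⟩
    + (t₁ + tp) +ℤ + a +ℤ + c       ≡⟨ cong (λ x → x +ℤ + a +ℤ + c) (pos-+ t₁ tp) ⟩
    ((+ t₁ +ℤ + tp) +ℤ + a) +ℤ + c  ∎

regroupˡ : ∀ s₀ a₀ z₀ n₁ z₁ → s₀ + a₀ + 2 * (z₀ + n₁ + z₁) ≡ a₀ + (n₁ + z₁) + (s₀ + 2 * z₀ + n₁ + z₁)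
regroupˡ = ℕ-Solver.solve-∀

regroupʳ : ∀ s₀ a₁ z₀ n₁ z₁ tp n₂ z₂ →
           tp + (a₁ + (n₂ + z₂)) + (s₀ + 2 * z₀ + n₁ + z₁) ≡ z₀ + n₁ + a₁ + tp + (s₀ + z₀) + (z₁ + n₂ + z₂)
regroupʳ = ℕ-Solver.solve-∀

count-arithmetic : ∀ {t₀ t₁ tp s₀ s₁ s₂ a₀ a₁ n₁ n₂ z₀ z₁ z₂} →
  t₀ ≡ s₀ + a₀ → t₁ ≡ s₁ + a₁ → s₁ ≡ z₀ + n₁ → s₂ ≡ z₁ + n₂ → a₀ + (n₁ + z₁) ≡ tp + (a₁ + (n₂ + z₂)) →
  t₀ + 2 * (s₁ + z₁) ≡ t₁ + tp + (s₀ + z₀) + (s₂ + z₂)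
count-arithmetic {tp = tp} {s₀} {a₀ = a₀} {a₁} {n₁} {n₂} {z₀} {z₁} {z₂} refl refl refl refl balance = begin
  s₀ + a₀ + 2 * (z₀ + n₁ + z₁)                    ≡⟨ regroupˡ s₀ a₀ z₀ n₁ z₁ ⟩
  a₀ + (n₁ + z₁) + (s₀ + 2 * z₀ + n₁ + z₁)        ≡⟨ cong (_+ (s₀ + 2 * z₀ + n₁ + z₁)) balance ⟩
  tp + (a₁ + (n₂ + z₂)) + (s₀ + 2 * z₀ + n₁ + z₁) ≡⟨ regroupʳ s₀ a₁ z₀ n₁ z₁ tp n₂ z₂ ⟩
  z₀ + n₁ + a₁ + tp + (s₀ + z₀) + (z₁ + n₂ + z₂)  ∎
  where open ≡-Reasoning

module PositiveGenus {g} (0<g : 0 < g) where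

  ≢[] : ∀ {G} → genus G ≡ g → G ≢ []
  ≢[] gen refl = <-irrefl gen 0<g

  no-efficacy-genus : ∀ {G} → ¬ NSgh g g G
  no-efficacy-genus nsgh@(ns , gen , _) = efficacy≢genus ns (≢[] gen) (trans (NSgh⇒efficacy nsgh) (sym gen))

  NSgh∩Descends≐SDgh : ∀ {b} → NSgh g b ∩ Descends ≐ SDgh g b
  NSgh∩Descends≐SDgh =
    (λ (nsgh@(ns , gen , _) , d) → nsgh , Equivalence.from (StronglyDescended⇔Descends ns (≢[] gen)) d) ,
    (λ (nsgh@(ns , gen , _) , sd) → nsgh , Equivalence.to (StronglyDescended⇔Descends ns (≢[] gen)) sd)

  SDgh∩Ordinary≐ordinary : ∀ {b} → SDgh g (suc b) ∩ Ordinary ≐ (λ G → G ≡ ordinary g × g ≡ b)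
  SDgh∩Ordinary≐ordinary = to , from
    where
    to : ∀ {b G} → (SDgh g (suc b) ∩ Ordinary) G → G ≡ ordinary g × g ≡ b
    to {b} {G} ((nsgh@(ns , gen , _) , _) , o) = G≡ , suc-injective (begin
      suc g                 ≡⟨ efficacy-ordinary g ⟨
      efficacy (ordinary g) ≡⟨ cong efficacy G≡ ⟨
      efficacy G            ≡⟨ NSgh⇒efficacy nsgh ⟩
      suc b                 ∎)
      where
      open ≡-Reasoning
      G≡ : G ≡ ordinary g
      G≡ = trans (Ordinary⇒≡ordinary ns (≢[] gen) o) (cong ordinary gen)
    from : ∀ {b G} → G ≡ ordinary g × g ≡ b → (SDgh g (suc b) ∩ Ordinary) G
    from (refl , refl) =
      (NSgh-intro ns (genus-ordinary g) (efficacy-ordinary g) ,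
       Equivalence.from (StronglyDescended⇔Descends ns ne) (Ordinary⇒Descends ns ne (ordinary-Ordinary g))) ,
      ordinary-Ordinary g
      where
      ns : IsNS (ordinary g)
      ns = ordinary-isNS g
      ne : ordinary g ≢ []
      ne = ≢[] (genus-ordinary g)

  NSrankCases : ℕ → List ℕ → Set
  NSrankCases b = (NSgh g b ∩ ∁ Descends) ∪ ((SDgh g (suc b) ∩ ∁ Ordinary) ∪ (λ G → G ≡ ordinary g × g ≡ suc b))

  NSrank≐ : ∀ {b} → NSrank g b ≐ NSrankCases b
  NSrank≐ {b} = to , from
    where
    to : NSrank g b ⊆ NSrankCases b
    to {G} (ns , gen , rank≡b) =
      [ (λ (eff≡ , ¬d) → inj₁ (NSgh-intro ns gen eff≡ , ¬d))
      , [ (λ (eff≡ , d , ¬o) → inj₂ (inj₁ (sdgh (NSgh-intro ns gen eff≡) d , ¬o)))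
        , (λ (eff≡ , o) → inj₂ (inj₂ (proj₁ SDgh∩Ordinary≐ordinary
                                            (sdgh (NSgh-intro ns gen eff≡) (Ordinary⇒Descends ns ne o) , o))))
        ]′ ]′ (Equivalence.to (rank-cases ns ne) rank≡b)
      where
      ne : G ≢ []
      ne = ≢[] gen
      sdgh : ∀ {k G} → NSgh g k G → Descends G → SDgh g k G
      sdgh nsgh d = proj₁ NSgh∩Descends≐SDgh (nsgh , d)
    from : NSrankCases b ⊆ NSrank g b
    from (inj₁ (nsgh@(ns , gen , _) , ¬d)) =
      ns , gen , Equivalence.from (rank-cases ns (≢[] gen)) (inj₁ (NSgh⇒efficacy nsgh , ¬d))
    from (inj₂ (inj₁ ((nsgh@(ns , gen , _) , sd) , ¬o))) = ns , gen , Equivalence.from (rank-cases ns (≢[] gen))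
      (inj₂ (inj₁ (NSgh⇒efficacy nsgh , Equivalence.to (StronglyDescended⇔Descends ns (≢[] gen)) sd , ¬o)))
    from (inj₂ (inj₂ is-ordinary)) =
      let (nsgh@(ns , gen , _) , _) , o = proj₂ SDgh∩Ordinary≐ordinary is-ordinary
      in ns , gen , Equivalence.from (rank-cases ns (≢[] gen)) (inj₂ (inj₂ (NSgh⇒efficacy nsgh , o)))

  init-injective : ∀ {b G G′} → NSrank g b G → NSrank g b G′ → init G ≡ init G′ → G ≡ G′
  init-injective {G = G} {G′} (ns , gen , rank≡b) (ns′ , gen′ , rank′≡b) init≡ = begin
    G                     ≡⟨ init-∷ʳ-last G (≢[] gen) ⟨
    init G ∷ʳ last G      ≡⟨ cong₂ _∷ʳ_ init≡ last≡ ⟩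
    init G′ ∷ʳ last G′    ≡⟨ init-∷ʳ-last G′ (≢[] gen′) ⟩
    G′                    ∎
    where
    open ≡-Reasoning
    last∈children : ∀ {G} → IsNS G → genus G ≡ g → last G ∈ children (init G)
    last∈children ns gen = children-listing (parent-isNS ns (≢[] gen)) .complete (last-child-of-parent ns (≢[] gen))
    last≡ : last G ≡ last G′
    last≡ = above-injective (children-sorted (init G)) (last∈children ns gen)
      (subst (λ P → last G′ ∈ children P) (sym init≡) (last∈children ns′ gen′))
      (trans rank≡b (trans (sym rank′≡b) (cong (λ P → above (last G′) (children P)) (sym init≡))))

  NSpredAbove≐parents : ∀ {b} → NSpredAbove g b ≐ (λ P → ∃ λ G → NSrank g b G × init G ≡ P)
  NSpredAbove≐parents {b} = to , from
    where
    to : NSpredAbove g b ⊆ (λ P → ∃ λ G → NSrank g b G × init G ≡ P)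
    to {P} (ns , gen , b<eff) =
      let x , x∈ , above≡b = above-surjective (children-sorted P) b<eff in
      P ∷ʳ x ,
      (proj₂ (children-listing ns .sound x∈) , trans (genus-∷ʳ P x) gen ,
       trans (cong₂ (λ l Q → above l (children Q)) (last-∷ʳ P x) (init-∷ʳ P x)) above≡b) ,
      init-∷ʳ P x
    from : (λ P → ∃ λ G → NSrank g b G × init G ≡ P) ⊆ NSpredAbove g b
    from (G , (ns , gen , rank≡b) , refl) =
      parent-isNS ns ne ,
      trans (sym (genus-∷ʳ (init G) (last G))) (trans (cong genus (init-∷ʳ-last G ne)) gen) ,
      subst (_< efficacy (init G)) rank≡b
        (above<length (children-listing (parent-isNS ns ne) .complete (last-child-of-parent ns ne)))
      where
      ne : G ≢ []
      ne = ≢[] gen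

  NSrank-count : ∀ {b a n} → HasCount (NSgh g b ∩ ∁ Descends) a → HasCount (SDgh g (suc b) ∩ ∁ Ordinary) n →
                 HasCount (NSrank g b) (a + (n + 𝟙 (g ≟ suc b)))
  NSrank-count {b} cA cN = count-resp (≐-sym NSrank≐)
    (count-∪ cA (count-∪ cN (count-if (g ≟ suc b) (ordinary g)) λ { (_ , ¬o) (refl , _) → ¬o (ordinary-Ordinary g) })
     λ { (_ , ¬d) (inj₁ (sdgh , _))  → ¬d (descends sdgh)
       ; (_ , ¬d) (inj₂ is-ordinary) → ¬d (descends (proj₁ (proj₂ SDgh∩Ordinary≐ordinary is-ordinary))) })
    where
    descends : ∀ {b G} → SDgh g b G → Descends G
    descends = proj₂ ∘ proj₂ NSgh∩Descends≐SDgh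

  NSpredAbove-count : ∀ {b n} → HasCount (NSrank g b) n → HasCount (NSpredAbove g b) n
  NSpredAbove-count c = count-resp (≐-sym NSpredAbove≐parents) (count-image init c init-injective)

  recurrence : ∀ {h t₀ t₁ tp s₀ s₁ s₂} →
    HasCount (NSgh g h) t₀ → HasCount (NSgh g (suc h)) t₁ → HasCount (NSpred g (suc h)) tp →
    HasCount (SDgh g h) s₀ → HasCount (SDgh g (suc h)) s₁ → HasCount (SDgh g (suc (suc h))) s₂ →
    t₀ + 2 * shat g (suc h) s₁ ≡ t₁ + tp + shat g h s₀ + shat g (suc (suc h)) s₂
  recurrence {h} {t₀} {t₁} {tp} {s₀} {s₁} {s₂} c₀ c₁ cp cs₀ cs₁ cs₂ =
    let a₀ , A₀ , t₀≡ = count-split descends? c₀ cs₀ NSgh∩Descends≐SDgh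
        a₁ , A₁ , t₁≡ = count-split descends? c₁ cs₁ NSgh∩Descends≐SDgh
        n₁ , N₁ , s₁≡ = count-split ordinary? cs₁ (count-if (g ≟ h) (ordinary g)) SDgh∩Ordinary≐ordinary
        n₂ , N₂ , s₂≡ = count-split ordinary? cs₂ (count-if (g ≟ suc h) (ordinary g)) SDgh∩Ordinary≐ordinary
        l , L , parents≡ = count-split (λ P → efficacy P ≟ suc h) (NSpredAbove-count (NSrank-count A₀ N₁)) cp
                                       NSpredAbove∩≡≐NSpred
        -- N(h) = t(g − 1, h + 1) + N(h + 1), counted on the parents
        balance = trans parents≡ (cong (_+_ tp)
                    (count-unique L (NSpredAbove-count (NSrank-count A₁ N₂)) NSpredAbove∩≢≐NSpredAbove))
    in begin
    t₀ + 2 * shat g (suc h) s₁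
      ≡⟨ cong (λ x → t₀ + 2 * x) (shat≡ g (suc h) s₁ (vanishes cs₁)) ⟩
    t₀ + 2 * (s₁ + 𝟙 (g ≟ suc h))
      ≡⟨ count-arithmetic {s₀ = s₀} {a₀ = a₀} {a₁} {n₁} {n₂} t₀≡ t₁≡ s₁≡ s₂≡ balance ⟩
    t₁ + tp + (s₀ + 𝟙 (g ≟ h)) + (s₂ + 𝟙 (g ≟ suc (suc h)))
      ≡⟨ cong₂ (λ x y → t₁ + tp + x + y) (shat≡ g h s₀ (vanishes cs₀)) (shat≡ g (suc (suc h)) s₂ (vanishes cs₂)) ⟨
    t₁ + tp + shat g h s₀ + shat g (suc (suc h)) s₂
      ∎
    where
    open ≡-Reasoning
    vanishes : ∀ {k s} → HasCount (SDgh g k) s → g ≡ k → s ≡ 0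
    vanishes c refl = count-unique c (count-none λ _ → no-efficacy-genus ∘ proj₁) (id , id)

genus≡0⇒[] : ∀ {G} → genus G ≡ 0 → G ≡ []
genus≡0⇒[] {[]} _ = refl

NSgh-genus-zero : ∀ {k} → NSgh 0 k ≐ (λ G → G ≡ [] × 1 ≡ k)
NSgh-genus-zero {k} = to , λ { (refl , refl) → NSgh-intro ([] , (λ ()) , λ _ _ _ _ ()) refl refl }
  where
  to : NSgh 0 k ⊆ (λ G → G ≡ [] × 1 ≡ k)
  to {G} nsgh@(_ , gen , _) with refl ← genus≡0⇒[] {G} gen = refl , NSgh⇒efficacy nsgh

SDgh-genus-zero : ∀ {k} → SDgh 0 k ≐ (λ G → G ≡ [] × 1 ≡ k)
SDgh-genus-zero = proj₁ NSgh-genus-zero ∘ proj₁ , λ G≡[]×1≡k → proj₂ NSgh-genus-zero G≡[]×1≡k , inj₁ (proj₁ G≡[]×1≡k)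

lemma5 : ∀ (g h : ℕ) → ¬ (g ≡ 0 × h ≡ 0) →
    ∀ (t₀ t₁ tp s₀ s₁ s₂ : ℕ) →
    HasCount (NSgh g h) t₀ →
    HasCount (NSgh g (suc h)) t₁ →
    HasCount (NSpred g (suc h)) tp →
    HasCount (SDgh g h) s₀ →
    HasCount (SDgh g (suc h)) s₁ →
    HasCount (SDgh g (suc (suc h))) s₂ →
    + t₀ ≡ ((+ t₁ +ℤ + tp) +ℤ + shat g h s₀)
             - (+ 2 *ℤ + shat g (suc h) s₁)
             +ℤ + shat g (suc (suc h)) s₂
lemma5 zero zero ¬g≡0×h≡0 = ⊥-elim (¬g≡0×h≡0 (refl , refl))
lemma5 zero (suc h) _ _ _ _ _ _ _ c₀ c₁ cp cs₀ cs₁ cs₂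
  with refl ← count-unique c₀ (count-if (1 ≟ suc h) []) NSgh-genus-zero
     | refl ← count-unique cs₀ (count-if (1 ≟ suc h) []) SDgh-genus-zero
     | refl ← count-unique c₁ (count-if (1 ≟ suc (suc h)) []) NSgh-genus-zero
     | refl ← count-unique cs₁ (count-if (1 ≟ suc (suc h)) []) SDgh-genus-zero
     | refl ← count-unique cs₂ (count-if (1 ≟ suc (suc (suc h))) []) SDgh-genus-zero
     | refl ← count-unique cp (count-none λ _ (_ , 1+genus≡0 , _) → 0≢1+n (sym 1+genus≡0)) (id , id)
  = ℕ-identity⇒ℤ {t₁ = 0} {tp = 0} {b = 0} {c = 0} refl
lemma5 g@(suc _) h _ _ t₁ tp s₀ s₁ s₂ c₀ c₁ cp cs₀ cs₁ cs₂ =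
  ℕ-identity⇒ℤ {t₁ = t₁} {tp} {shat g h s₀} {shat g (suc h) s₁} {shat g (suc (suc h)) s₂}
    (PositiveGenus.recurrence (s≤s z≤n) c₀ c₁ cp cs₀ cs₁ cs₂)
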